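{- For every positive integer $n$, \[ \overline{\mathrm{spt}}_{\omega}(n)\equiv\overline{\mathrm{spt}}(n)\equiv\begin{cases}1\pmod 2 & \text{if } n=k^2 \text{ or } n=2k^2 \text{ for some integer } k,\\ 0\pmod 2&\text{otherwise.}\end{cases} \]
   Context: With $(a;q)_n=\prod_{k=0}^{n-1}(1-aq^k)$ and $(a;q)_\infty=\prod_{k\ge0}(1-aq^k)$: $\sum_{n\ge1}\overline{\mathrm{spt}}(n)q^n=\sum_{n\ge1}\frac{q^n(-q^{n+1};q)_\infty}{(1-q^n)^2(q^{n+1};q)_\infty}$ (the number of smallest parts in overpartitions of $n$ whose smallest part is overlined), and $\sum_{n\ge1}\overline{\mathrm{spt}}_{\omega}(n)q^n=\sum_{n\ge1}\frac{q^{n}(-q^{n+1};q)_{n}(-q^{2n+2};q^2)_{\infty}}{(1-q^n)^2(q^{n+1};q)_n(q^{2n+2};q^2)_{\infty}}$ (the number of smallest parts in overpartitions of $n$ whose smallest part is overlined and all of whose odd parts are less than twice the smallest part). -}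

module Defs where

open import Data.Nat using (ℕ; zero; suc; _+_; _*_; _∸_; _≤_; _<_; _≟_)
open import Data.Nat.Divisibility using (_∣?_)
open import Data.List using (List; map; upTo)
open import Data.Nat.ListAction using (sum)
open import Relation.Nullary.Decidable using (does)
open import Data.Bool using (if_then_else_)
open import Data.Product using (∃-syntax)
open import Data.Sum using (_⊎_)
open import Relation.Binary.PropositionalEquality using (_≡_)

-- Formal power series in q with natural-number coefficients,
-- represented by their coefficient function: f n = [q^n] f.
Series : Set
Series = ℕ → ℕ

one : Series
one zero    = 1
one (suc _) = 0

_⊛_ : Series → Series → Series
(f ⊛ g) n = sum (map (λ i → f i * g (n ∸ i)) (upTo (suc n)))

infixl 7 _⊛_

-- 1/(1 - q^k) = Σ_{j≥0} q^{kj}   (used only for k ≥ 1)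
geom : ℕ → Series
geom k n = if does (k ∣? n) then 1 else 0

-- 1 + q^k   (used only for k ≥ 1)
onePlus : ℕ → Series
onePlus k n = if does (n ≟ 0) then 1 else (if does (n ≟ k) then 1 else 0)

fac : ℕ → Series
fac k = onePlus k ⊛ geom k

prodN : (ℕ → Series) → ℕ → Series
prodN F zero      = one
prodN F (suc len) = prodN F len ⊛ F len

-- infinite product ∏_{j≥0} F j, where every factor F j is of the form
-- 1 + O(q^{j+1}) (true for all uses below, since F j = fac k with k ≥ j+1).
-- Hence the coefficient of q^n only depends on the factors j ≤ n.
prodInf : (ℕ → Series) → Series
prodInf F n = prodN F (suc n) n

-- [q^n] of  1/(1-q^m)^2 · (-q^{m+1};q)_∞ / (q^{m+1};q)_∞
--        =  1/(1-q^m)^2 · ∏_{j≥0} (1+q^{m+1+j})/(1-q^{m+1+j})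
sptTerm : ℕ → Series
sptTerm m = geom m ⊛ geom m ⊛ prodInf (λ j → fac (suc m + j))

-- [q^n] of  1/(1-q^m)^2 · (-q^{m+1};q)_m / (q^{m+1};q)_m
--            · (-q^{2m+2};q^2)_∞ / (q^{2m+2};q^2)_∞
sptωTerm : ℕ → Series
sptωTerm m = geom m ⊛ geom m
           ⊛ prodN (λ j → fac (suc m + j)) m
           ⊛ prodInf (λ j → fac (2 * m + 2 + 2 * j))

-- spt-bar(n) = [q^n] Σ_{m≥1} q^m · sptTerm m ;  terms with m > n vanish.
sptbar : ℕ → ℕ
sptbar n = sum (map (λ i → sptTerm (suc i) (n ∸ suc i)) (upTo n))

-- spt-bar_ω(n) = [q^n] Σ_{m≥1} q^m · sptωTerm m
sptbarω : ℕ → ℕ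
sptbarω n = sum (map (λ i → sptωTerm (suc i) (n ∸ suc i)) (upTo n))

-- n = k^2 or n = 2 k^2 for some integer k (k ∈ ℕ suffices since k^2 = |k|^2)
SqOrTwiceSq : ℕ → Set
SqOrTwiceSq n = ∃[ k ] (n ≡ k * k ⊎ n ≡ 2 * (k * k))

-- Everything is computed in the field ℙ = ℤ/2 of parities, into which ℕ maps by the
-- semiring homomorphism `parity`.  The proof has three steps.
-- 1. Every factor (1 + q^k)/(1 - q^k) is ≡ 1 modulo 2, so the m-th terms of both
--    generating functions reduce to 1/(1 - q^m)², which by the Frobenius identity
--    f² ≡ f(q²) is ≡ 1/(1 - q^{2m}).  This already gives sptbar_ω(n) ≡ sptbar(n).
-- 2. Σ_{m ≥ 1} q^m/(1 - q^{2m}) counts the m such that n/m is odd, i.e. the divisors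
--    of n plus the divisors of n/2.
-- 3. Divisors d ↔ n/d pair up, so a divisor count is odd exactly for squares; and
--    n cannot be both a square and twice a square (irrationality of √2).

module Submission where

open import Defs
open import Data.Nat using (ℕ; parity; zero; suc; z<s; _+_; _*_; _∸_; _≤_; _<_; _%_; _≟_; _≤?_; _<?_; z≤n; s≤s; NonZero; >-nonZero; ≢-nonZero; ≢-nonZero⁻¹; >-nonZero⁻¹)
open import Data.Nat.Properties
open import Data.Nat.DivMod using ([m+kn]%n≡m%n)
open import Data.Nat.Divisibility
open import Data.Parity.Base using (Parity; 0ℙ; 1ℙ; _⁻¹) renaming (_+_ to _⊕_; _*_ to _⊗_)
import Data.Parity.Properties as ℙ
open import Algebra.Properties.CommutativeSemigroup ℙ.+-commutativeSemigroup using (interchange)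
open import Data.Product using (_×_; _,_)
open import Data.Sum using (inj₁; inj₂)
open import Data.Nat.Induction using (<-rec)
open import Data.Nat.Solver using (module +-*-Solver)
open +-*-Solver using (solve; _:*_; _:=_; con)
open import Relation.Binary.Definitions using (tri<; tri≈; tri>)
open import Relation.Nullary using (¬_; Dec; yes; no; does; contradiction)
open import Data.Bool using (if_then_else_)
open import Data.List using (map; upTo; [_]; _++_; _∷ʳ_)
open import Data.List.Properties using (upTo-∷ʳ; map-++)
open import Data.Nat.ListAction using (sum)
open import Data.Nat.ListAction.Properties using (sum-++)
open import Relation.Binary.PropositionalEquality using (_≡_; _≢_; refl; sym; trans; cong; cong₂; subst; ≢-sym; module ≡-Reasoning)

∑ : ℕ → (ℕ → Parity) → Parity
∑ zero    h = 0ℙ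
∑ (suc N) h = ∑ N h ⊕ h N

-- ∑ binds more loosely than ⊕ and ⊗ (which share one precedence level in the library).
infix 5 ∑
syntax ∑ N (λ i → e) = ∑[ i < N ] e

∑-cong : ∀ {h g : ℕ → Parity} N → (∀ i → i < N → h i ≡ g i) → ∑ N h ≡ ∑ N g
∑-cong zero    eq = refl
∑-cong (suc N) eq = cong₂ _⊕_ (∑-cong N (λ i i<N → eq i (m<n⇒m<1+n i<N))) (eq N ≤-refl)

∑-⊕ : ∀ (h g : ℕ → Parity) N → ∑[ i < N ] (h i ⊕ g i) ≡ ∑ N h ⊕ ∑ N g
∑-⊕ h g zero    = refl
∑-⊕ h g (suc N) = trans (cong (_⊕ (h N ⊕ g N)) (∑-⊕ h g N)) (interchange (∑ N h) (∑ N g) (h N) (g N))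

∑-front : ∀ (h : ℕ → Parity) N → ∑ (suc N) h ≡ h 0 ⊕ (∑[ i < N ] h (suc i))
∑-front h zero    = ℙ.+-comm 0ℙ (h 0)
∑-front h (suc N) = trans (cong (_⊕ h (suc N)) (∑-front h N)) (ℙ.+-assoc (h 0) _ (h (suc N)))

∑-zero : ∀ {h : ℕ → Parity} N → (∀ i → i < N → h i ≡ 0ℙ) → ∑ N h ≡ 0ℙ
∑-zero zero    eq = refl
∑-zero (suc N) eq = cong₂ _⊕_ (∑-zero N (λ i i<N → eq i (m<n⇒m<1+n i<N))) (eq N ≤-refl)

∑-single : ∀ {h : ℕ → Parity} N c → c < N → (∀ i → i < N → i ≢ c → h i ≡ 0ℙ) → ∑ N h ≡ h c
∑-single {h} (suc N) c c<1+N eq with c ≟ N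
... | yes refl = cong (_⊕ h c) (∑-zero N (λ i i<c → eq i (m<n⇒m<1+n i<c) (<⇒≢ i<c)))
... | no c≢N   = begin
  ∑ N h ⊕ h N ≡⟨ cong₂ _⊕_ (∑-single N c (≤∧≢⇒< (≤-pred c<1+N) c≢N) (λ i i<N → eq i (m<n⇒m<1+n i<N)))
                           (eq N ≤-refl (≢-sym c≢N)) ⟩
  h c ⊕ 0ℙ    ≡⟨ ℙ.+-identityʳ (h c) ⟩
  h c         ∎
  where open ≡-Reasoning

-- The sum of a symmetric square array equals the sum of its diagonal:
-- the off-diagonal entries F a b and F b a cancel in pairs.
∑-symmetric : ∀ (F : ℕ → ℕ → Parity) → (∀ a b → F a b ≡ F b a) → ∀ K →
              ∑[ a < K ] ∑[ b < K ] F a b ≡ ∑[ a < K ] F a a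
∑-symmetric F F-sym zero    = refl
∑-symmetric F F-sym (suc K) = begin
  ∑[ a < suc K ] ∑[ b < suc K ] F a b
    ≡⟨ cong (_⊕ (row ⊕ F K K)) (∑-⊕ (λ a → ∑[ b < K ] F a b) (λ a → F a K) K) ⟩
  ((∑[ a < K ] ∑[ b < K ] F a b) ⊕ column) ⊕ (row ⊕ F K K)
    ≡⟨ cong (λ x → ((∑[ a < K ] ∑[ b < K ] F a b) ⊕ x) ⊕ (row ⊕ F K K)) column≡row ⟩
  ((∑[ a < K ] ∑[ b < K ] F a b) ⊕ row) ⊕ (row ⊕ F K K)
    ≡⟨ cancel (∑[ a < K ] ∑[ b < K ] F a b) row (F K K) ⟩
  (∑[ a < K ] ∑[ b < K ] F a b) ⊕ F K K
    ≡⟨ cong (_⊕ F K K) (∑-symmetric F F-sym K) ⟩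
  ∑[ a < suc K ] F a a ∎
  where
  open ≡-Reasoning
  row column : Parity
  row    = ∑[ b < K ] F K b
  column = ∑[ a < K ] F a K
  column≡row : column ≡ row
  column≡row = ∑-cong K (λ a _ → F-sym a K)
  cancel : ∀ x y z → (x ⊕ y) ⊕ (y ⊕ z) ≡ x ⊕ z
  cancel x y z = begin
    (x ⊕ y) ⊕ (y ⊕ z) ≡⟨ ℙ.+-assoc x y (y ⊕ z) ⟩
    x ⊕ (y ⊕ (y ⊕ z)) ≡⟨ cong (x ⊕_) (sym (ℙ.+-assoc y y z)) ⟩
    x ⊕ ((y ⊕ y) ⊕ z) ≡⟨ cong (λ w → x ⊕ (w ⊕ z)) (ℙ.p+p≡0ℙ y) ⟩
    x ⊕ z             ∎

⟦_⟧ : ∀ {A : Set} → Dec A → Parity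
⟦ yes _ ⟧ = 1ℙ
⟦ no _  ⟧ = 0ℙ

⟦⟧-yes : ∀ {A : Set} (a? : Dec A) → A → ⟦ a? ⟧ ≡ 1ℙ
⟦⟧-yes (yes _) a = refl
⟦⟧-yes (no ¬a) a = contradiction a ¬a

⟦⟧-no : ∀ {A : Set} (a? : Dec A) → ¬ A → ⟦ a? ⟧ ≡ 0ℙ
⟦⟧-no (yes a) ¬a = contradiction a ¬a
⟦⟧-no (no _)  ¬a = refl

⟦⟧-true : ∀ {A : Set} (a? : Dec A) → ⟦ a? ⟧ ≡ 1ℙ → A
⟦⟧-true (yes a) _ = a

parity-if : ∀ {A : Set} (a? : Dec A) → parity (if does a? then 1 else 0) ≡ ⟦ a? ⟧
parity-if (yes _) = refl
parity-if (no _)  = refl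

⟦⟧-⇔ : ∀ {A B : Set} (a? : Dec A) (b? : Dec B) → (A → B) → (B → A) → ⟦ a? ⟧ ≡ ⟦ b? ⟧
⟦⟧-⇔ (yes a) b? f g = sym (⟦⟧-yes b? (f a))
⟦⟧-⇔ (no ¬a) b? f g = sym (⟦⟧-no b? (λ b → ¬a (g b)))

module _ {P : ℕ → Set} (P? : ∀ i → Dec (P i)) (h : ℕ → Parity) where

  ∑-sift : ∀ N c → c < N → P c → (∀ i → i < N → P i → i ≡ c) → ∑[ i < N ] h i ⊗ ⟦ P? i ⟧ ≡ h c
  ∑-sift N c c<N Pc unique = begin
    ∑[ i < N ] h i ⊗ ⟦ P? i ⟧ ≡⟨ ∑-single N c c<N off-c ⟩
    h c ⊗ ⟦ P? c ⟧           ≡⟨ cong (h c ⊗_) (⟦⟧-yes (P? c) Pc) ⟩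
    h c ⊗ 1ℙ                 ≡⟨ ℙ.*-identityʳ (h c) ⟩
    h c                      ∎
    where
    open ≡-Reasoning
    off-c : ∀ i → i < N → i ≢ c → h i ⊗ ⟦ P? i ⟧ ≡ 0ℙ
    off-c i i<N i≢c = trans (cong (h i ⊗_) (⟦⟧-no (P? i) (λ Pi → i≢c (unique i i<N Pi)))) (ℙ.*-zeroʳ (h i))

  ∑-sift-none : ∀ N → (∀ i → i < N → ¬ P i) → ∑[ i < N ] h i ⊗ ⟦ P? i ⟧ ≡ 0ℙ
  ∑-sift-none N none = ∑-zero N (λ i i<N → trans (cong (h i ⊗_) (⟦⟧-no (P? i) (none i i<N))) (ℙ.*-zeroʳ (h i)))

parity-sum : ∀ (f : ℕ → ℕ) n → parity (sum (map f (upTo n))) ≡ ∑[ i < n ] parity (f i)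
parity-sum f zero    = refl
parity-sum f (suc n) = begin
  parity (sum (map f (upTo (suc n))))            ≡⟨ cong (λ xs → parity (sum (map f xs))) (sym (upTo-∷ʳ n)) ⟩
  parity (sum (map f (upTo n ∷ʳ n)))             ≡⟨ cong (λ xs → parity (sum xs)) (map-++ f (upTo n) [ n ]) ⟩
  parity (sum (map f (upTo n) ++ [ f n ]))       ≡⟨ cong parity (sum-++ (map f (upTo n)) [ f n ]) ⟩
  parity (sum (map f (upTo n)) + (f n + 0))      ≡⟨ ℙ.+-homo-+ (sum (map f (upTo n))) (f n + 0) ⟩
  parity (sum (map f (upTo n))) ⊕ parity (f n + 0) ≡⟨ cong₂ _⊕_ (parity-sum f n) (cong parity (+-identityʳ (f n))) ⟩
  (∑[ i < n ] parity (f i)) ⊕ parity (f n)       ∎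
  where open ≡-Reasoning

parity-⊛ : ∀ f g n → parity ((f ⊛ g) n) ≡ ∑[ i < suc n ] parity (f i) ⊗ parity (g (n ∸ i))
parity-⊛ f g n = trans (parity-sum (λ i → f i * g (n ∸ i)) (suc n))
                       (∑-cong (suc n) (λ i _ → ℙ.*-homo-* (f i) (g (n ∸ i))))

⟦2∣⟧≡parity⁻¹ : ∀ t → ⟦ 2 ∣? t ⟧ ≡ parity t ⁻¹
⟦2∣⟧≡parity⁻¹ zero          = ⟦⟧-yes (2 ∣? 0) (2 ∣0)
⟦2∣⟧≡parity⁻¹ (suc zero)    = ⟦⟧-no (2 ∣? 1) (λ 2∣1 → contradiction (∣⇒≤ 2∣1) (<-irrefl refl))
⟦2∣⟧≡parity⁻¹ (suc (suc t)) =
  trans (⟦⟧-⇔ (2 ∣? 2 + t) (2 ∣? t) (λ 2∣2+t → ∣m+n∣m⇒∣n 2∣2+t ∣-refl) (∣m∣n⇒∣m+n ∣-refl))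
        (⟦2∣⟧≡parity⁻¹ t)

toℕ : Parity → ℕ
toℕ 0ℙ = 0
toℕ 1ℙ = 1

%2≡toℕ∘parity : ∀ n → n % 2 ≡ toℕ (parity n)
%2≡toℕ∘parity zero          = refl
%2≡toℕ∘parity (suc zero)    = refl
%2≡toℕ∘parity (suc (suc n)) = trans (trans (cong (_% 2) (+-comm 2 n)) ([m+kn]%n≡m%n n 1 2)) (%2≡toℕ∘parity n)

_≈₂_ : Series → Series → Set
f ≈₂ g = ∀ n → parity (f n) ≡ parity (g n)

infix 4 _≈₂_

≈₂-trans : ∀ {f g h} → f ≈₂ g → g ≈₂ h → f ≈₂ h
≈₂-trans f≈g g≈h n = trans (f≈g n) (g≈h n)

⊛-cong : ∀ {f f′ g g′} → f ≈₂ f′ → g ≈₂ g′ → f ⊛ g ≈₂ f′ ⊛ g′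
⊛-cong {f} {f′} {g} {g′} f≈f′ g≈g′ n = begin
  parity ((f ⊛ g) n)                                  ≡⟨ parity-⊛ f g n ⟩
  ∑[ i < suc n ] parity (f i) ⊗ parity (g (n ∸ i))    ≡⟨ ∑-cong (suc n) (λ i _ → cong₂ _⊗_ (f≈f′ i) (g≈g′ (n ∸ i))) ⟩
  ∑[ i < suc n ] parity (f′ i) ⊗ parity (g′ (n ∸ i))  ≡⟨ parity-⊛ f′ g′ n ⟨
  parity ((f′ ⊛ g′) n)                                ∎
  where open ≡-Reasoning

parity-one : ∀ j → parity (one j) ≡ ⟦ j ≟ 0 ⟧
parity-one zero    = refl
parity-one (suc j) = refl

⊛-identityʳ : ∀ f → f ⊛ one ≈₂ f
⊛-identityʳ f n = begin
  parity ((f ⊛ one) n)                               ≡⟨ parity-⊛ f one n ⟩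
  ∑[ i < suc n ] parity (f i) ⊗ parity (one (n ∸ i)) ≡⟨ ∑-cong (suc n) (λ i _ → cong (parity (f i) ⊗_) (parity-one (n ∸ i))) ⟩
  ∑[ i < suc n ] parity (f i) ⊗ ⟦ n ∸ i ≟ 0 ⟧        ≡⟨ ∑-sift (λ i → n ∸ i ≟ 0) (λ i → parity (f i)) (suc n) n ≤-refl (n∸n≡0 n) only-n ⟩
  parity (f n)                                       ∎
  where
  open ≡-Reasoning
  only-n : ∀ i → i < suc n → n ∸ i ≡ 0 → i ≡ n
  only-n i i<1+n n∸i≡0 = ≤-antisym (≤-pred i<1+n) (m∸n≡0⇒m≤n n∸i≡0)

⊛-≈₂one : ∀ f g → g ≈₂ one → f ⊛ g ≈₂ f
⊛-≈₂one f g g≈1 = ≈₂-trans {f ⊛ g} {f ⊛ one} {f} (⊛-cong {f} {f} {g} {one} (λ _ → refl) g≈1) (⊛-identityʳ f)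

prodN-≈₂one : ∀ (F : ℕ → Series) → (∀ j → F j ≈₂ one) → ∀ len → prodN F len ≈₂ one
prodN-≈₂one F F≈1 zero      _ = refl
prodN-≈₂one F F≈1 (suc len)   = ≈₂-trans {prodN F len ⊛ F len} {prodN F len} {one}
                                  (⊛-≈₂one (prodN F len) (F len) (F≈1 len)) (prodN-≈₂one F F≈1 len)

prodInf-≈₂one : ∀ (F : ℕ → Series) → (∀ j → F j ≈₂ one) → prodInf F ≈₂ one
prodInf-≈₂one F F≈1 n = prodN-≈₂one F F≈1 (suc n) n

parity-onePlus : ∀ k .{{_ : NonZero k}} i → parity (onePlus k i) ≡ ⟦ i ≟ 0 ⟧ ⊕ ⟦ i ≟ k ⟧
parity-onePlus k zero    = cong (1ℙ ⊕_) (sym (⟦⟧-no (0 ≟ k) (≢-sym (≢-nonZero⁻¹ k))))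
parity-onePlus k (suc i) = parity-if (suc i ≟ k)

module _ (k : ℕ) .{{_ : NonZero k}} (f : Series) (n : ℕ) where

  private
    shifted : Parity
    shifted = ∑[ i < suc n ] parity (f (n ∸ i)) ⊗ ⟦ i ≟ k ⟧

  onePlus-⊛-expand : parity ((onePlus k ⊛ f) n) ≡ parity (f n) ⊕ shifted
  onePlus-⊛-expand = begin
    parity ((onePlus k ⊛ f) n)
      ≡⟨ parity-⊛ (onePlus k) f n ⟩
    ∑[ i < suc n ] parity (onePlus k i) ⊗ parity (f (n ∸ i))
      ≡⟨ ∑-cong (suc n) (λ i _ → trans (ℙ.*-comm (parity (onePlus k i)) (parity (f (n ∸ i))))
                                       (cong (parity (f (n ∸ i)) ⊗_) (parity-onePlus k i))) ⟩
    ∑[ i < suc n ] parity (f (n ∸ i)) ⊗ (⟦ i ≟ 0 ⟧ ⊕ ⟦ i ≟ k ⟧)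
      ≡⟨ ∑-cong (suc n) (λ i _ → ℙ.*-distribˡ-+ (parity (f (n ∸ i))) ⟦ i ≟ 0 ⟧ ⟦ i ≟ k ⟧) ⟩
    ∑[ i < suc n ] ((parity (f (n ∸ i)) ⊗ ⟦ i ≟ 0 ⟧) ⊕ (parity (f (n ∸ i)) ⊗ ⟦ i ≟ k ⟧))
      ≡⟨ ∑-⊕ _ _ (suc n) ⟩
    (∑[ i < suc n ] parity (f (n ∸ i)) ⊗ ⟦ i ≟ 0 ⟧) ⊕ shifted
      ≡⟨ cong (_⊕ shifted) (∑-sift (_≟ 0) (λ i → parity (f (n ∸ i))) (suc n) 0 (s≤s z≤n) refl (λ _ _ i≡0 → i≡0)) ⟩
    parity (f n) ⊕ shifted
      ∎
    where open ≡-Reasoning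

  onePlus-⊛-above : k ≤ n → parity ((onePlus k ⊛ f) n) ≡ parity (f n) ⊕ parity (f (n ∸ k))
  onePlus-⊛-above k≤n = trans onePlus-⊛-expand (cong (parity (f n) ⊕_)
    (∑-sift (_≟ k) (λ i → parity (f (n ∸ i))) (suc n) k (s≤s k≤n) refl (λ _ _ i≡k → i≡k)))

  onePlus-⊛-below : n < k → parity ((onePlus k ⊛ f) n) ≡ parity (f n)
  onePlus-⊛-below n<k = trans onePlus-⊛-expand (trans (cong (parity (f n) ⊕_)
    (∑-sift-none (_≟ k) (λ i → parity (f (n ∸ i))) (suc n)
                 (λ i i<1+n i≡k → <⇒≱ n<k (subst (_≤ n) i≡k (≤-pred i<1+n)))))
    (ℙ.+-identityʳ (parity (f n))))

-- The factor (1 + q^k)/(1 - q^k) is ≡ 1 modulo 2, since 1 + q^k ≡ 1 - q^k.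
fac-≈₂one : ∀ k .{{_ : NonZero k}} → fac k ≈₂ one
fac-≈₂one k zero = trans (onePlus-⊛-below k (geom k) 0 (>-nonZero⁻¹ k))
                        (trans (parity-if (k ∣? 0)) (⟦⟧-yes (k ∣? 0) (k ∣0)))
fac-≈₂one k (suc n) with k ≤? suc n
... | yes k≤n = begin
  parity (fac k (suc n))                                  ≡⟨ onePlus-⊛-above k (geom k) (suc n) k≤n ⟩
  parity (geom k (suc n)) ⊕ parity (geom k (suc n ∸ k))   ≡⟨ cong₂ _⊕_ (parity-if (k ∣? suc n)) (parity-if (k ∣? suc n ∸ k)) ⟩
  ⟦ k ∣? suc n ⟧ ⊕ ⟦ k ∣? suc n ∸ k ⟧                      ≡⟨ cong (_⊕ ⟦ k ∣? suc n ∸ k ⟧) k∣n⇔k∣n-k ⟩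
  ⟦ k ∣? suc n ∸ k ⟧ ⊕ ⟦ k ∣? suc n ∸ k ⟧                  ≡⟨ ℙ.p+p≡0ℙ ⟦ k ∣? suc n ∸ k ⟧ ⟩
  0ℙ                                                      ∎
  where
  open ≡-Reasoning
  k∣n⇔k∣n-k : ⟦ k ∣? suc n ⟧ ≡ ⟦ k ∣? suc n ∸ k ⟧
  k∣n⇔k∣n-k = ⟦⟧-⇔ (k ∣? suc n) (k ∣? suc n ∸ k)
    (λ k∣n → ∣m+n∣m⇒∣n (subst (k ∣_) (sym (m+[n∸m]≡n k≤n)) k∣n) ∣-refl)
    (λ k∣n-k → ∣m∸n∣n⇒∣m k k≤n k∣n-k ∣-refl)
... | no k≰n = trans (onePlus-⊛-below k (geom k) (suc n) (≰⇒> k≰n))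
                     (trans (parity-if (k ∣? suc n)) (⟦⟧-no (k ∣? suc n) (λ k∣n → k≰n (∣⇒≤ k∣n))))

sptTerm≈₂ : ∀ m → sptTerm m ≈₂ geom m ⊛ geom m
sptTerm≈₂ m = ⊛-≈₂one (geom m ⊛ geom m) _ (prodInf-≈₂one _ (λ j → fac-≈₂one (suc m + j)))

sptωTerm≈₂ : ∀ m → sptωTerm m ≈₂ geom m ⊛ geom m
sptωTerm≈₂ m = ≈₂-trans {sptωTerm m} {geom m ⊛ geom m ⊛ finite} {geom m ⊛ geom m}
  (⊛-≈₂one (geom m ⊛ geom m ⊛ finite) _ (prodInf-≈₂one _ (λ j → fac-≈₂one (2 * m + 2 + 2 * j) {{nonZero j}})))
  (⊛-≈₂one (geom m ⊛ geom m) finite (prodN-≈₂one _ (λ j → fac-≈₂one (suc m + j)) m))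
  where
  finite : Series
  finite = prodN (λ j → fac (suc m + j)) m
  nonZero : ∀ j → NonZero (2 * m + 2 + 2 * j)
  nonZero j = >-nonZero (≤-trans (s≤s z≤n) (≤-trans (m≤n+m 2 (2 * m)) (m≤m+n (2 * m + 2) (2 * j))))

a+a≡2*a : ∀ a → a + a ≡ 2 * a
a+a≡2*a a = cong (a +_) (sym (+-identityʳ a))

-- Frobenius modulo 2: in f², the cross terms f a f b and f b f a cancel,
-- leaving only the squares f a ^ 2 ≡ f a at even exponents 2a.
frobenius : ∀ f N → parity ((f ⊛ f) N) ≡ ∑[ a < suc N ] parity (f a) ⊗ ⟦ a + a ≟ N ⟧
frobenius f N = begin
  parity ((f ⊛ f) N)                                        ≡⟨ parity-⊛ f f N ⟩
  ∑[ a < suc N ] pf a ⊗ pf (N ∸ a)                           ≡⟨ ∑-cong (suc N) (λ a a≤N → sym (row a (≤-pred a≤N))) ⟩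
  ∑[ a < suc N ] ∑[ b < suc N ] F a b                        ≡⟨ ∑-symmetric F F-sym (suc N) ⟩
  ∑[ a < suc N ] (pf a ⊗ pf a) ⊗ ⟦ a + a ≟ N ⟧              ≡⟨ ∑-cong (suc N) (λ a _ → cong (_⊗ ⟦ a + a ≟ N ⟧) (ℙ.*-idem (pf a))) ⟩
  ∑[ a < suc N ] pf a ⊗ ⟦ a + a ≟ N ⟧                        ∎
  where
  open ≡-Reasoning
  pf : ℕ → Parity
  pf a = parity (f a)
  F : ℕ → ℕ → Parity
  F a b = (pf a ⊗ pf b) ⊗ ⟦ a + b ≟ N ⟧
  F-sym : ∀ a b → F a b ≡ F b a
  F-sym a b = cong₂ _⊗_ (ℙ.*-comm (pf a) (pf b)) (cong (λ x → ⟦ x ≟ N ⟧) (+-comm a b))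
  row : ∀ a → a ≤ N → ∑[ b < suc N ] F a b ≡ pf a ⊗ pf (N ∸ a)
  row a a≤N = ∑-sift (λ b → a + b ≟ N) (λ b → pf a ⊗ pf b) (suc N) (N ∸ a) (s≤s (m∸n≤m N a))
                     (m+[n∸m]≡n a≤N) (λ b _ a+b≡N → trans (sym (m+n∸m≡n a b)) (cong (_∸ a) a+b≡N))

geom-square : ∀ m → geom m ⊛ geom m ≈₂ geom (2 * m)
geom-square m N = begin
  parity ((geom m ⊛ geom m) N)                         ≡⟨ frobenius (geom m) N ⟩
  ∑[ a < suc N ] parity (geom m a) ⊗ ⟦ a + a ≟ N ⟧     ≡⟨ ∑-cong (suc N) (λ a _ → cong (_⊗ ⟦ a + a ≟ N ⟧) (parity-if (m ∣? a))) ⟩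
  ∑[ a < suc N ] ⟦ m ∣? a ⟧ ⊗ ⟦ a + a ≟ N ⟧            ≡⟨ diagonal (2 ∣? N) ⟩
  ⟦ 2 * m ∣? N ⟧                                       ≡⟨ parity-if (2 * m ∣? N) ⟨
  parity (geom (2 * m) N)                              ∎
  where
  open ≡-Reasoning
  diagonal : Dec (2 ∣ N) → ∑[ a < suc N ] ⟦ m ∣? a ⟧ ⊗ ⟦ a + a ≟ N ⟧ ≡ ⟦ 2 * m ∣? N ⟧
  diagonal (yes (divides h N≡h*2)) = trans
    (∑-sift (λ a → a + a ≟ N) (λ a → ⟦ m ∣? a ⟧) (suc N) h (s≤s h≤N) h+h≡N
            (λ a _ a+a≡N → *-cancelˡ-≡ a h 2 (trans (sym (a+a≡2*a a)) (trans a+a≡N (sym 2h≡N)))))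
    (⟦⟧-⇔ (m ∣? h) (2 * m ∣? N) (λ m∣h → subst (2 * m ∣_) 2h≡N (*-monoʳ-∣ 2 m∣h))
                                (λ 2m∣N → *-cancelˡ-∣ 2 (subst (2 * m ∣_) (sym 2h≡N) 2m∣N)))
    where
    2h≡N : 2 * h ≡ N
    2h≡N = trans (*-comm 2 h) (sym N≡h*2)
    h+h≡N : h + h ≡ N
    h+h≡N = trans (a+a≡2*a h) 2h≡N
    h≤N : h ≤ N
    h≤N = subst (h ≤_) h+h≡N (m≤m+n h h)
  diagonal (no 2∤N) = trans
    (∑-sift-none (λ a → a + a ≟ N) (λ a → ⟦ m ∣? a ⟧) (suc N)
                 (λ a _ a+a≡N → 2∤N (divides a (trans (sym a+a≡N) (trans (a+a≡2*a a) (*-comm 2 a))))))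
    (sym (⟦⟧-no (2 * m ∣? N) (λ 2m∣N → 2∤N (∣-trans (m∣m*n m) 2m∣N))))

termSum : (ℕ → Series) → ℕ → ℕ
termSum T n = sum (map (λ i → T (suc i) (n ∸ suc i)) (upTo n))

termSum-cong : ∀ T U → (∀ m → T m ≈₂ U m) → ∀ n → parity (termSum T n) ≡ parity (termSum U n)
termSum-cong T U T≈U n = begin
  parity (termSum T n)                              ≡⟨ parity-sum (λ i → T (suc i) (n ∸ suc i)) n ⟩
  ∑[ i < n ] parity (T (suc i) (n ∸ suc i))        ≡⟨ ∑-cong n (λ i _ → T≈U (suc i) (n ∸ suc i)) ⟩
  ∑[ i < n ] parity (U (suc i) (n ∸ suc i))        ≡⟨ parity-sum (λ i → U (suc i) (n ∸ suc i)) n ⟨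
  parity (termSum U n)                              ∎
  where open ≡-Reasoning

-- q^m/(1 - q^{2m}) = Σ_j q^{(2j+1)m} picks out the odd multiples of m:
-- 2m ∣ n - m  exactly when  m ∣ n  but not  2m ∣ n.
oddMultiple : ∀ m n .{{_ : NonZero m}} → m ≤ n → ⟦ 2 * m ∣? n ∸ m ⟧ ≡ ⟦ m ∣? n ⟧ ⊕ ⟦ 2 * m ∣? n ⟧
oddMultiple m n m≤n with m ∣? n
... | no m∤n = trans (⟦⟧-no (2 * m ∣? n ∸ m) (λ 2m∣n-m → m∤n (∣m∸n∣n⇒∣m m m≤n (m*n∣⇒n∣ 2 m 2m∣n-m) ∣-refl)))
                     (sym (⟦⟧-no (2 * m ∣? n) (λ 2m∣n → m∤n (m*n∣⇒n∣ 2 m 2m∣n))))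
... | yes (divides zero refl)    = contradiction (n≤0⇒n≡0 m≤n) (≢-nonZero⁻¹ m)
... | yes (divides (suc s) refl) = begin
  ⟦ 2 * m ∣? suc s * m ∸ m ⟧  ≡⟨ cong (λ x → ⟦ 2 * m ∣? x ⟧) (m+n∸m≡n m (s * m)) ⟩
  ⟦ 2 * m ∣? s * m ⟧          ≡⟨ ⟦⟧-⇔ (2 * m ∣? s * m) (2 ∣? s) (*-cancelʳ-∣ m) (*-monoˡ-∣ m) ⟩
  ⟦ 2 ∣? s ⟧                  ≡⟨ ⟦2∣⟧≡parity⁻¹ s ⟩
  parity s ⁻¹                 ≡⟨ cong _⁻¹ (ℙ.suc-homo-⁻¹ s) ⟨
  1ℙ ⊕ parity (suc s) ⁻¹      ≡⟨ cong (1ℙ ⊕_) (⟦2∣⟧≡parity⁻¹ (suc s)) ⟨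
  1ℙ ⊕ ⟦ 2 ∣? suc s ⟧         ≡⟨ cong (1ℙ ⊕_) (⟦⟧-⇔ (2 ∣? suc s) (2 * m ∣? suc s * m) (*-monoˡ-∣ m) (*-cancelʳ-∣ m)) ⟩
  1ℙ ⊕ ⟦ 2 * m ∣? suc s * m ⟧ ∎
  where open ≡-Reasoning

divisorParity : ℕ → ℕ → Parity
divisorParity c n = ∑[ d < suc n ] ⟦ c * d ∣? n ⟧

representationParity : ℕ → ℕ → Parity
representationParity c n = ∑[ a < suc n ] ⟦ c * (a * a) ≟ n ⟧

divisorParity-positive : ∀ c n → 0 < n → divisorParity c n ≡ ∑[ i < n ] ⟦ c * suc i ∣? n ⟧
divisorParity-positive c n 0<n =
  trans (∑-front (λ d → ⟦ c * d ∣? n ⟧) n)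
        (cong (_⊕ (∑[ i < n ] ⟦ c * suc i ∣? n ⟧)) (⟦⟧-no (c * 0 ∣? n) c*0∤n))
  where
  c*0∤n : ¬ (c * 0 ∣ n)
  c*0∤n c*0∣n = >⇒≢ 0<n (0∣⇒≡0 (subst (_∣ n) (*-zeroʳ c) c*0∣n))

-- The d with c d ∣ n pair up as d ↔ n/(c d); modulo 2 only the fixed points,
-- where c d² = n, survive.
divisors≡representations : ∀ c n → 0 < n → divisorParity c n ≡ representationParity c n
divisors≡representations c n 0<n = begin
  ∑[ a < suc n ] ⟦ c * a ∣? n ⟧          ≡⟨ ∑-cong (suc n) (λ a _ → sym (row a (c * a ∣? n))) ⟩
  ∑[ a < suc n ] ∑[ b < suc n ] F a b    ≡⟨ ∑-symmetric F F-sym (suc n) ⟩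
  ∑[ a < suc n ] ⟦ c * (a * a) ≟ n ⟧     ∎
  where
  open ≡-Reasoning
  F : ℕ → ℕ → Parity
  F a b = ⟦ c * (a * b) ≟ n ⟧
  F-sym : ∀ a b → F a b ≡ F b a
  F-sym a b = cong (λ x → ⟦ c * x ≟ n ⟧) (*-comm a b)
  c*[a*b]≡b*[c*a] : ∀ a b → c * (a * b) ≡ b * (c * a)
  c*[a*b]≡b*[c*a] a b = trans (sym (*-assoc c a b)) (*-comm (c * a) b)
  row : ∀ a → Dec (c * a ∣ n) → ∑[ b < suc n ] F a b ≡ ⟦ c * a ∣? n ⟧
  row a (yes (divides q n≡q*ca)) = trans
    (∑-sift (λ b → c * (a * b) ≟ n) (λ _ → 1ℙ) (suc n) q (s≤s q≤n) (trans (c*[a*b]≡b*[c*a] a q) (sym n≡q*ca))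
            (λ b _ e → *-cancelʳ-≡ b q (c * a) (trans (sym (c*[a*b]≡b*[c*a] a b)) (trans e n≡q*ca))))
    (sym (⟦⟧-yes (c * a ∣? n) (divides q n≡q*ca)))
    where
    instance
      ca≢0 : NonZero (c * a)
      ca≢0 = ≢-nonZero (λ ca≡0 → >⇒≢ 0<n (trans n≡q*ca (trans (cong (q *_) ca≡0) (*-zeroʳ q))))
    q≤n : q ≤ n
    q≤n = subst (q ≤_) (sym n≡q*ca) (m≤m*n q (c * a))
  row a (no ca∤n) = trans
    (∑-sift-none (λ b → c * (a * b) ≟ n) (λ _ → 1ℙ) (suc n)
                 (λ b _ e → ca∤n (divides b (trans (sym e) (c*[a*b]≡b*[c*a] a b)))))
    (sym (⟦⟧-no (c * a ∣? n) ca∤n))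

square-<-reflect : ∀ x y → x * x < y * y → x < y
square-<-reflect x y xx<yy with x <? y
... | yes x<y = x<y
... | no x≮y  = contradiction (*-mono-≤ (≮⇒≥ x≮y) (≮⇒≥ x≮y)) (<⇒≱ xx<yy)

square-injective : ∀ x y → x * x ≡ y * y → x ≡ y
square-injective x y xx≡yy with <-cmp x y
... | tri< x<y _ _ = contradiction xx≡yy (<⇒≢ (*-mono-< x<y x<y))
... | tri≈ _ x≡y _ = x≡y
... | tri> _ _ y<x = contradiction (sym xx≡yy) (<⇒≢ (*-mono-< y<x y<x))

-- n = c k² has exactly one solution k when it has any (and n > 0), so the count is odd.
representationParity-yes : ∀ c n k → 0 < n → n ≡ c * (k * k) → representationParity c n ≡ 1ℙ
representationParity-yes zero n k 0<n n≡0 = contradiction n≡0 (>⇒≢ 0<n)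
representationParity-yes c@(suc _) n k 0<n n≡ckk =
  ∑-sift (λ a → c * (a * a) ≟ n) (λ _ → 1ℙ) (suc n) k (s≤s (subst (k ≤_) (sym n≡ckk) (k≤ckk k))) (sym n≡ckk)
         (λ a _ e → square-injective a k (*-cancelˡ-≡ (a * a) (k * k) c (trans e n≡ckk)))
  where
  k≤ckk : ∀ k → k ≤ c * (k * k)
  k≤ckk zero      = z≤n
  k≤ckk k@(suc _) = ≤-trans (m≤m*n k k) (m≤n*m (k * k) c)

representationParity-no : ∀ c n → (∀ k → n ≢ c * (k * k)) → representationParity c n ≡ 0ℙ
representationParity-no c n none = ∑-sift-none (λ a → c * (a * a) ≟ n) (λ _ → 1ℙ) (suc n) (λ a _ e → none a (sym e))

even-square : ∀ k → 2 ∣ k * k → 2 ∣ k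
even-square k 2∣kk = ⟦⟧-true (2 ∣? k) (begin
  ⟦ 2 ∣? k ⟧                    ≡⟨ ⟦2∣⟧≡parity⁻¹ k ⟩
  parity k ⁻¹                   ≡⟨ cong _⁻¹ (ℙ.*-idem (parity k)) ⟨
  (parity k ⊗ parity k) ⁻¹      ≡⟨ cong _⁻¹ (ℙ.*-homo-* k k) ⟨
  parity (k * k) ⁻¹             ≡⟨ ⟦2∣⟧≡parity⁻¹ (k * k) ⟨
  ⟦ 2 ∣? k * k ⟧                ≡⟨ ⟦⟧-yes (2 ∣? k * k) 2∣kk ⟩
  1ℙ                            ∎)
  where open ≡-Reasoning

[h*2]²≡2*[2*h²] : ∀ h → (h * 2) * (h * 2) ≡ 2 * (2 * (h * h))
[h*2]²≡2*[2*h²] = solve 1 (λ h → (h :* con 2) :* (h :* con 2) := con 2 :* (con 2 :* (h :* h))) refl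

-- Irrationality of √2 by infinite descent: k² = 2 j² forces j = 0,
-- since k = 2h would give j² = 2 h² with h < j.
twiceSquare-square : ∀ j k → k * k ≡ 2 * (j * j) → j ≡ 0
twiceSquare-square = <-rec (λ j → ∀ k → k * k ≡ 2 * (j * j) → j ≡ 0) descent
  where
  descent : ∀ j → (∀ {h} → h < j → ∀ k → k * k ≡ 2 * (h * h) → h ≡ 0) → ∀ k → k * k ≡ 2 * (j * j) → j ≡ 0
  descent zero      _  _ _      = refl
  descent j@(suc _) IH k kk≡2jj with even-square k (divides (j * j) (trans kk≡2jj (*-comm 2 (j * j))))
  ... | divides zero      refl = contradiction kk≡2jj (λ ())
  ... | divides h@(suc _) refl = contradiction (IH h<j j jj≡2hh) (λ ())
    where
    jj≡2hh : j * j ≡ 2 * (h * h)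
    jj≡2hh = *-cancelˡ-≡ (j * j) (2 * (h * h)) 2 (trans (sym kk≡2jj) ([h*2]²≡2*[2*h²] h))
    h<j : h < j
    h<j = square-<-reflect h j (subst (h * h <_) (sym jj≡2hh) (m<m+n (h * h) z<s))

not-square-and-twiceSquare : ∀ n k j → 0 < n → n ≡ k * k → n ≢ 2 * (j * j)
not-square-and-twiceSquare n k j 0<n n≡kk n≡2jj with twiceSquare-square j k (trans (sym n≡kk) n≡2jj)
... | refl = >⇒≢ 0<n n≡2jj

sptbar-reduced : ∀ n → parity (sptbar n) ≡ parity (termSum (λ m → geom (2 * m)) n)
sptbar-reduced = termSum-cong sptTerm (λ m → geom (2 * m))
  (λ m → ≈₂-trans {sptTerm m} {geom m ⊛ geom m} {geom (2 * m)} (sptTerm≈₂ m) (geom-square m))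

sptbarω-reduced : ∀ n → parity (sptbarω n) ≡ parity (termSum (λ m → geom (2 * m)) n)
sptbarω-reduced = termSum-cong sptωTerm (λ m → geom (2 * m))
  (λ m → ≈₂-trans {sptωTerm m} {geom m ⊛ geom m} {geom (2 * m)} (sptωTerm≈₂ m) (geom-square m))

reduced-divisors : ∀ n → 0 < n → parity (termSum (λ m → geom (2 * m)) n) ≡ divisorParity 1 n ⊕ divisorParity 2 n
reduced-divisors n 0<n = begin
  parity (termSum (λ m → geom (2 * m)) n)
    ≡⟨ parity-sum (λ i → geom (2 * suc i) (n ∸ suc i)) n ⟩
  ∑[ i < n ] parity (geom (2 * suc i) (n ∸ suc i))
    ≡⟨ ∑-cong n (λ i i<n → trans (parity-if (2 * suc i ∣? n ∸ suc i)) (oddMultiple (suc i) n i<n)) ⟩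
  ∑[ i < n ] (⟦ suc i ∣? n ⟧ ⊕ ⟦ 2 * suc i ∣? n ⟧)
    ≡⟨ ∑-⊕ (λ i → ⟦ suc i ∣? n ⟧) (λ i → ⟦ 2 * suc i ∣? n ⟧) n ⟩
  (∑[ i < n ] ⟦ suc i ∣? n ⟧) ⊕ (∑[ i < n ] ⟦ 2 * suc i ∣? n ⟧)
    ≡⟨ cong (_⊕ (∑[ i < n ] ⟦ 2 * suc i ∣? n ⟧)) (∑-cong n (λ i _ → cong (λ d → ⟦ d ∣? n ⟧) (sym (*-identityˡ (suc i))))) ⟩
  (∑[ i < n ] ⟦ 1 * suc i ∣? n ⟧) ⊕ (∑[ i < n ] ⟦ 2 * suc i ∣? n ⟧)
    ≡⟨ cong₂ _⊕_ (divisorParity-positive 1 n 0<n) (divisorParity-positive 2 n 0<n) ⟨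
  divisorParity 1 n ⊕ divisorParity 2 n
    ∎
  where open ≡-Reasoning

sptbar-representations : ∀ n → 0 < n → parity (sptbar n) ≡ representationParity 1 n ⊕ representationParity 2 n
sptbar-representations n 0<n = begin
  parity (sptbar n)                                     ≡⟨ sptbar-reduced n ⟩
  parity (termSum (λ m → geom (2 * m)) n)               ≡⟨ reduced-divisors n 0<n ⟩
  divisorParity 1 n ⊕ divisorParity 2 n                 ≡⟨ cong₂ _⊕_ (divisors≡representations 1 n 0<n) (divisors≡representations 2 n 0<n) ⟩
  representationParity 1 n ⊕ representationParity 2 n   ∎
  where open ≡-Reasoning

-- Since n = k² and n = 2j² exclude each other, exactly one representation exists or none.
representations-yes : ∀ n → 0 < n → SqOrTwiceSq n → representationParity 1 n ⊕ representationParity 2 n ≡ 1ℙ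
representations-yes n 0<n (k , inj₁ n≡kk) = cong₂ _⊕_
  (representationParity-yes 1 n k 0<n (trans n≡kk (sym (*-identityˡ (k * k)))))
  (representationParity-no 2 n (λ j → not-square-and-twiceSquare n k j 0<n n≡kk))
representations-yes n 0<n (k , inj₂ n≡2kk) = cong₂ _⊕_
  (representationParity-no 1 n (λ j n≡1jj → not-square-and-twiceSquare n j k 0<n (trans n≡1jj (*-identityˡ (j * j))) n≡2kk))
  (representationParity-yes 2 n k 0<n n≡2kk)

representations-no : ∀ n → ¬ SqOrTwiceSq n → representationParity 1 n ⊕ representationParity 2 n ≡ 0ℙ
representations-no n ¬sq = cong₂ _⊕_
  (representationParity-no 1 n (λ k n≡1kk → ¬sq (k , inj₁ (trans n≡1kk (*-identityˡ (k * k))))))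
  (representationParity-no 2 n (λ k n≡2kk → ¬sq (k , inj₂ n≡2kk)))

theorem1p6 : (n : ℕ) → 0 < n →
    (sptbarω n % 2 ≡ sptbar n % 2)
    × (SqOrTwiceSq n → sptbar n % 2 ≡ 1)
    × (¬ SqOrTwiceSq n → sptbar n % 2 ≡ 0)
theorem1p6 n 0<n = same-parity , odd-if-representable , even-otherwise
  where
  sptbar%2 : ∀ {b} → parity (sptbar n) ≡ b → sptbar n % 2 ≡ toℕ b
  sptbar%2 eq = trans (%2≡toℕ∘parity (sptbar n)) (cong toℕ eq)
  same-parity : sptbarω n % 2 ≡ sptbar n % 2
  same-parity = trans (%2≡toℕ∘parity (sptbarω n))
                      (sym (sptbar%2 (trans (sptbar-reduced n) (sym (sptbarω-reduced n)))))
  odd-if-representable : SqOrTwiceSq n → sptbar n % 2 ≡ 1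
  odd-if-representable sq = sptbar%2 (trans (sptbar-representations n 0<n) (representations-yes n 0<n sq))
  even-otherwise : ¬ SqOrTwiceSq n → sptbar n % 2 ≡ 0
  even-otherwise ¬sq = sptbar%2 (trans (sptbar-representations n 0<n) (representations-no n ¬sq))
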